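{- Let $G$ be a cyclic group of order $n$ and let $1 < d_1 < d_2 < \dots < d_k < n$ be the divisors of $n$ strictly between $1$ and $n$. Then the number of edges of $\mathrm{Endo}(G)$ is $$\binom{n}{2} - \sum_{\substack{1 \le i < j \le k \\ d_i \nmid d_j}} \phi(d_i)\phi(d_j),$$ where $\phi$ is Euler's totient function.
   Context: For a finite group $G$, $\mathrm{Endo}(G)$ is the simple undirected graph with vertex set $G$ in which distinct $a,b$ are adjacent iff there is a group endomorphism of $G$ mapping $a$ to $b$ or mapping $b$ to $a$. -}

module Defs where

open import Data.Nat using (ℕ; suc; _+_; _*_; _∸_; _<_; _<?_; NonZero)
open import Data.Nat.DivMod using (_mod_)
open import Data.Nat.Divisibility using (_∣_; _∣?_)
open import Data.Nat.Coprimality using (coprime?)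
open import Data.Fin using (Fin; toℕ)
import Data.Fin as Fin
open import Data.List using (List; upTo; map; filter; length)
open import Data.Nat.ListAction using (sum)
open import Data.Product using (Σ; _×_)
open import Data.Sum using (_⊎_)
open import Relation.Nullary using (¬?)
open import Relation.Nullary.Decidable using (_×-dec_)
open import Relation.Binary.PropositionalEquality using (_≡_)

-- The cyclic group of order n, modelled as ℤ/nℤ with carrier Fin n
-- and addition modulo n.
_⊕_ : {n : ℕ} .{{_ : NonZero n}} → Fin n → Fin n → Fin n
_⊕_ {n} a b = (toℕ a + toℕ b) mod n

-- Group endomorphisms of ℤ/nℤ (a map preserving the group operation;
-- preservation of identity and inverses follows in any group).
IsEndo : {n : ℕ} .{{_ : NonZero n}} → (Fin n → Fin n) → Set
IsEndo f = ∀ a b → f (a ⊕ b) ≡ f a ⊕ f b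

Maps : {n : ℕ} .{{_ : NonZero n}} → Fin n → Fin n → Set
Maps {n} a b = Σ (Fin n → Fin n) λ f → IsEndo f × f a ≡ b

-- adjacency in Endo(ℤ/nℤ) (distinctness is imposed in Edge via u < v)
Adjacent : {n : ℕ} .{{_ : NonZero n}} → Fin n → Fin n → Set
Adjacent a b = Maps a b ⊎ Maps b a

-- An edge of Endo(ℤ/nℤ): an unordered pair {u,v} of distinct vertices,
-- represented uniquely by u < v; the adjacency proof is irrelevant, so
-- edges are counted, not witnesses.
record Edge (n : ℕ) .{{_ : NonZero n}} : Set where
  constructor edge
  field
    u v : Fin n
    .u<v : u Fin.< v
    .adj : Adjacent u v

φ : ℕ → ℕ
φ d = length (filter (λ k → coprime? k d) (map suc (upTo d)))

properDivisors : ℕ → List ℕ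
properDivisors n = filter (λ d → d ∣? n) (map (2 +_) (upTo (n ∸ 2)))

-- Σ_{i<j, d_i ∤ d_j} φ(d_i) φ(d_j)  (d_i < d_j iff i < j as the list is increasing)
nonDivSum : ℕ → ℕ
nonDivSum n =
  sum (map (λ d → sum (map (λ e → φ d * φ e)
        (filter (λ e → (d <? e) ×-dec ¬? (d ∣? e)) (properDivisors n))))
      (properDivisors n))

{-# OPTIONS --safe #-}
module Submission where

-- Every endomorphism of ℤ/n is multiplication by some c, so some endomorphism sends a to b
-- exactly when gcd(a, n) ∣ b, i.e. when ord b ∣ ord a.  Hence a and b are adjacent iff their
-- orders are comparable under divisibility.  Incomparable divisors of n are distinct and
-- proper, and ℤ/n has exactly φ(d) elements of order d ∣ n.  Counting the non-adjacent
-- pairs over ordered pairs (twice the count, as incomparability is symmetric and irreflexive)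
-- and grouping them by the orders of their endpoints gives the subtracted sum.

open import Defs
open import Data.Nat using (ℕ; _+_; NonZero)
open import Data.Nat.Combinatorics using (_C_)
open import Data.Fin using (Fin)
open import Data.Product using (Σ; _×_)
open import Function.Bundles using (_↔_)
open import Relation.Binary.PropositionalEquality using (_≡_)

open import Level using (Level)
open import Data.Bool using (if_then_else_; true; false)
open import Data.Empty using (⊥-elim-irr)
open import Data.Fin as Fin using (toℕ)
open import Data.Fin.Properties using (toℕ-injective; toℕ-fromℕ<; toℕ<n; +↔⊎)
open import Data.Irrelevant using (Irrelevant; [_])
open import Data.List using ([]; _∷_; map; filter; length; applyUpTo; upTo)
open import Data.List.Properties using (map-∘)
open import Data.Nat using (zero; suc; pred; _*_; _∸_; _<_; _<?_; _≟_; z<s; s<s; ≢-nonZero; ≢-nonZero⁻¹; >-nonZero; >-nonZero⁻¹)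
open import Data.Nat.Combinatorics using (nC1≡n; nCk+nC[k+1]≡[n+1]C[k+1])
open import Data.Nat.Coprimality using (Coprime; coprime?; coprime⇒gcd≡1; gcd≡1⇒coprime)
open import Data.Nat.DivMod using (_%_; _mod_; %-distribˡ-+; %-distribˡ-*; m%n%n≡m%n; [m+kn]%n≡m%n; m<n⇒m%n≡m; m≡m%n+[m/n]*n; _/_)
open import Data.Nat.Divisibility using (_∣_; _∣?_; divides; quotient; quotient-∣; quotient≢0; ∣-refl; ∣-trans; ∣⇒≤; >⇒∤; _∣0; 0∣⇒≡0; 1∣_; ∣m+n∣m⇒∣n; ∣m⇒∣m*n; *-monoʳ-∣; *-cancelʳ-∣; %-presˡ-∣)
open import Data.Nat.GCD using (gcd; gcd-GCD; gcd[m,n]∣m; gcd[m,n]∣n; gcd[m,n]≢0; gcd-greatest; c*gcd[m,n]≡gcd[cm,cn]; module Bézout)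
open import Data.Nat.ListAction using (sum)
open import Data.Nat.Properties
open import Data.Nat.Solver using (module +-*-Solver)
open import Data.Product using (_,_; proj₁; proj₂; ∃)
open import Data.Product.Function.NonDependent.Propositional using (_×-⇔_)
open import Data.Sum using (_⊎_; inj₁; inj₂; [_,_]′; swap)
open import Data.Sum.Function.Propositional using (_⊎-↔_; _⊎-⇔_)
open import Function using (_∘_; id; flip)
open import Function.Bundles using (_⇔_; mk⇔; mk↔ₛ′; Equivalence)
open import Function.Construct.Composition using (_⇔-∘_)
open import Function.Construct.Identity using (⇔-id)
open import Function.Properties.Inverse using (↔-sym; ↔-trans)
open import Relation.Nullary using (Dec; yes; no; does; ¬_; ¬?; contradiction)
open import Relation.Nullary.Decidable using (_×-dec_; _⊎-dec_; does-⇔)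
open import Relation.Unary using (Decidable)
open import Relation.Binary.PropositionalEquality using (refl; sym; trans; cong; cong₂; subst; module ≡-Reasoning)
open +-*-Solver using (solve; _:=_; _:+_; _:*_; con)
open ≡-Reasoning

private
  variable
    a b : Level
    A : Set a
    B : Set b

𝟙 : Dec A → ℕ
𝟙 a? = if does a? then 1 else 0

𝟙-yes : A → (a? : Dec A) → 𝟙 a? ≡ 1
𝟙-yes _ (yes _) = refl
𝟙-yes a (no ¬a) = contradiction a ¬a

𝟙-no : ¬ A → (a? : Dec A) → 𝟙 a? ≡ 0
𝟙-no ¬a (yes a) = contradiction a ¬a
𝟙-no _  (no _)  = refl

𝟙-cong : A ⇔ B → (a? : Dec A) (b? : Dec B) → 𝟙 a? ≡ 𝟙 b?
𝟙-cong A⇔B a? b? = cong (λ x → if x then 1 else 0) (does-⇔ A⇔B a? b?)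

𝟙-× : (a? : Dec A) (b? : Dec B) → 𝟙 (a? ×-dec b?) ≡ 𝟙 a? * 𝟙 b?
𝟙-× (yes _) b? = sym (+-identityʳ (𝟙 b?))
𝟙-× (no _)  _  = refl

𝟙+𝟙¬≡1 : (a? : Dec A) → 𝟙 a? + 𝟙 (¬? a?) ≡ 1
𝟙+𝟙¬≡1 (yes _) = refl
𝟙+𝟙¬≡1 (no _)  = refl

*𝟙-cong : ∀ {x y} (a? : Dec A) → (A → x ≡ y) → x * 𝟙 a? ≡ y * 𝟙 a?
*𝟙-cong (yes a) x≡y = cong (_* 1) (x≡y a)
*𝟙-cong {x = x} {y} (no _) _ = trans (*-zeroʳ x) (sym (*-zeroʳ y))

∑ : ℕ → (ℕ → ℕ) → ℕ
∑ zero    f = 0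
∑ (suc n) f = f 0 + ∑ n (f ∘ suc)

infix 5 ∑
syntax ∑ n (λ i → e) = ∑[ i < n ] e

∑-cong< : ∀ n {f g : ℕ → ℕ} → (∀ i → i < n → f i ≡ g i) → ∑ n f ≡ ∑ n g
∑-cong< zero    _  = refl
∑-cong< (suc n) eq = cong₂ _+_ (eq 0 z<s) (∑-cong< n (λ i i<n → eq (suc i) (s<s i<n)))

∑-cong : ∀ n {f g : ℕ → ℕ} → (∀ i → f i ≡ g i) → ∑ n f ≡ ∑ n g
∑-cong n eq = ∑-cong< n (λ i _ → eq i)

∑-zero : ∀ n {f : ℕ → ℕ} → (∀ i → i < n → f i ≡ 0) → ∑ n f ≡ 0
∑-zero zero    _  = refl
∑-zero (suc n) eq = cong₂ _+_ (eq 0 z<s) (∑-zero n (λ i i<n → eq (suc i) (s<s i<n)))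

∑-1 : ∀ n → ∑ n (λ _ → 1) ≡ n
∑-1 zero    = refl
∑-1 (suc n) = cong suc (∑-1 n)

∑-distrib-+ : ∀ n (f g : ℕ → ℕ) → ∑[ i < n ] (f i + g i) ≡ ∑ n f + ∑ n g
∑-distrib-+ zero    f g = refl
∑-distrib-+ (suc n) f g = trans (cong (f 0 + g 0 +_) (∑-distrib-+ n (f ∘ suc) (g ∘ suc)))
  (solve 4 (λ a b c d → (a :+ b) :+ (c :+ d) := (a :+ c) :+ (b :+ d)) refl (f 0) (g 0) _ _)

∑-distribˡ-* : ∀ n c (f : ℕ → ℕ) → ∑[ i < n ] (c * f i) ≡ c * ∑ n f
∑-distribˡ-* zero    c f = sym (*-zeroʳ c)
∑-distribˡ-* (suc n) c f =
  trans (cong (c * f 0 +_) (∑-distribˡ-* n c (f ∘ suc))) (sym (*-distribˡ-+ c (f 0) _))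

∑-distribʳ-* : ∀ n c (f : ℕ → ℕ) → ∑[ i < n ] (f i * c) ≡ ∑ n f * c
∑-distribʳ-* zero    c f = refl
∑-distribʳ-* (suc n) c f =
  trans (cong (f 0 * c +_) (∑-distribʳ-* n c (f ∘ suc))) (sym (*-distribʳ-+ c (f 0) _))

∑-comm : ∀ m n (f : ℕ → ℕ → ℕ) → ∑[ i < m ] ∑[ j < n ] f i j ≡ ∑[ j < n ] ∑[ i < m ] f i j
∑-comm zero    n f = sym (∑-zero n (λ _ _ → refl))
∑-comm (suc m) n f = trans (cong (∑ n (f 0) +_) (∑-comm m n (f ∘ suc)))
  (sym (∑-distrib-+ n (f 0) (λ j → ∑[ i < m ] f (suc i) j)))

∑-+ : ∀ m n (f : ℕ → ℕ) → ∑ (m + n) f ≡ ∑ m f + (∑[ i < n ] f (m + i))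
∑-+ zero    n f = refl
∑-+ (suc m) n f = trans (cong (f 0 +_) (∑-+ m n (f ∘ suc))) (sym (+-assoc (f 0) _ _))

∑-init-last : ∀ n (f : ℕ → ℕ) → ∑ (suc n) f ≡ ∑ n f + f n
∑-init-last zero    f = +-identityʳ (f 0)
∑-init-last (suc n) f =
  trans (cong (f 0 +_) (∑-init-last n (f ∘ suc))) (sym (+-assoc (f 0) _ _))

∑-δ : ∀ K {h} (F : ℕ → ℕ) → h < K → ∑[ d < K ] 𝟙 (h ≟ d) * F d ≡ F h
∑-δ (suc K) {zero}  F _ =
  trans (cong₂ _+_ (*-identityˡ (F 0)) (∑-zero K (λ _ _ → refl))) (+-identityʳ (F 0))
∑-δ (suc K) {suc h} F (s<s h<K) = ∑-δ K (F ∘ suc) h<K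

∑-multiples : (k : ℕ) .{{_ : NonZero k}} (d : ℕ) {f : ℕ → ℕ} → (∀ u → ¬ k ∣ u → f u ≡ 0) →
              ∑ (d * k) f ≡ ∑[ i < d ] f (i * k)
∑-multiples k zero    _     = refl
∑-multiples k (suc d) {f} vanishes = begin
  ∑ (k + d * k) f                    ≡⟨ ∑-+ k (d * k) f ⟩
  ∑ k f + (∑[ u < d * k ] f (k + u)) ≡⟨ cong₂ _+_ (first-block k vanishes)
                                          (∑-multiples k d (λ u k∤u → vanishes (k + u) (k∤u ∘ k∣k+u⇒k∣u))) ⟩
  f 0 + (∑[ i < d ] f (k + i * k))   ∎
  where
  k∣k+u⇒k∣u : ∀ {u} → k ∣ k + u → k ∣ u
  k∣k+u⇒k∣u k∣k+u = ∣m+n∣m⇒∣n k∣k+u ∣-refl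
  first-block : ∀ k → (∀ u → ¬ k ∣ u → f u ≡ 0) → .{{_ : NonZero k}} → ∑ k f ≡ f 0
  first-block (suc k) vanishes =
    trans (cong (f 0 +_) (∑-zero k (λ i i<k → vanishes (suc i) (>⇒∤ (s<s i<k))))) (+-identityʳ (f 0))

∑∑ : ℕ → (ℕ → ℕ → ℕ) → ℕ
∑∑ n f = ∑[ i < n ] ∑[ j < n ] f i j

∑∑< : ℕ → (ℕ → ℕ → ℕ) → ℕ
∑∑< n f = ∑[ i < n ] ∑[ j < n ] 𝟙 (i <? j) * f i j

∑∑-symmetric : ∀ n (f : ℕ → ℕ → ℕ) → (∀ i j → f i j ≡ f j i) → (∀ i → f i i ≡ 0) →
               ∑∑ n f ≡ 2 * ∑∑< n f
∑∑-symmetric zero    f f-sym f-diag = refl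
∑∑-symmetric (suc n) f f-sym f-diag = begin
  ∑∑ (suc n) f
    ≡⟨ cong₂ _+_ (cong (_+ R) (f-diag 0)) (∑-distrib-+ n _ _) ⟩
  R + ((∑[ i < n ] f (suc i) 0) + ∑∑ n f′)
    ≡⟨ cong₂ (λ x y → R + (x + y)) (∑-cong n (λ i → f-sym (suc i) 0))
         (∑∑-symmetric n f′ (λ i j → f-sym (suc i) (suc j)) (f-diag ∘ suc)) ⟩
  R + (R + 2 * ∑∑< n f′)
    ≡⟨ solve 2 (λ r t → r :+ (r :+ con 2 :* t) := con 2 :* (r :+ t)) refl R (∑∑< n f′) ⟩
  2 * (R + ∑∑< n f′)
    ≡⟨ cong (λ x → 2 * (x + ∑∑< n f′)) (∑-cong n (λ j → *-identityˡ (f 0 (suc j)))) ⟨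
  2 * ∑∑< (suc n) f ∎
  where
  f′ : ℕ → ℕ → ℕ
  f′ i j = f (suc i) (suc j)
  R : ℕ
  R = ∑[ j < n ] f 0 (suc j)

∑∑<-1≡C2 : ∀ n → ∑∑< n (λ _ _ → 1) ≡ n C 2
∑∑<-1≡C2 zero    = refl
∑∑<-1≡C2 (suc n) = begin
  ∑ n (λ _ → 1) + ∑∑< n (λ _ _ → 1)  ≡⟨ cong₂ _+_ (trans (∑-1 n) (sym (nC1≡n n))) (∑∑<-1≡C2 n) ⟩
  n C 1 + n C 2                      ≡⟨ nCk+nC[k+1]≡[n+1]C[k+1] n 1 ⟩
  suc n C 2                          ∎

∑∑<-complement : ∀ n {R : ℕ → ℕ → Set a} (R? : ∀ i j → Dec (R i j)) →
                 ∑∑< n (λ i j → 𝟙 (R? i j)) + ∑∑< n (λ i j → 𝟙 (¬? (R? i j))) ≡ n C 2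
∑∑<-complement n R? = begin
  ∑∑< n (λ i j → 𝟙 (R? i j)) + ∑∑< n (λ i j → 𝟙 (¬? (R? i j)))  ≡⟨ ∑-distrib-+ n _ _ ⟨
  ∑[ i < n ] ((∑[ j < n ] 𝟙 (i <? j) * 𝟙 (R? i j)) + (∑[ j < n ] 𝟙 (i <? j) * 𝟙 (¬? (R? i j))))
      ≡⟨ ∑-cong n (λ i → trans (sym (∑-distrib-+ n _ _)) (∑-cong n (split i))) ⟩
  ∑∑< n (λ _ _ → 1)                                               ≡⟨ ∑∑<-1≡C2 n ⟩
  n C 2                                                           ∎
  where
  split : ∀ i j → 𝟙 (i <? j) * 𝟙 (R? i j) + 𝟙 (i <? j) * 𝟙 (¬? (R? i j)) ≡ 𝟙 (i <? j) * 1
  split i j = trans (sym (*-distribˡ-+ (𝟙 (i <? j)) _ _)) (cong (𝟙 (i <? j) *_) (𝟙+𝟙¬≡1 (R? i j)))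

#fibre : ℕ → (ℕ → ℕ) → ℕ → ℕ
#fibre n h d = ∑[ u < n ] 𝟙 (h u ≟ d)

∑-fibres : ∀ n K (h F : ℕ → ℕ) → (∀ u → u < n → h u < K) →
           ∑[ u < n ] F (h u) ≡ ∑[ d < K ] #fibre n h d * F d
∑-fibres n K h F h<K = begin
  ∑[ u < n ] F (h u)                           ≡⟨ ∑-cong< n (λ u u<n → ∑-δ K F (h<K u u<n)) ⟨
  ∑[ u < n ] ∑[ d < K ] 𝟙 (h u ≟ d) * F d      ≡⟨ ∑-comm n K _ ⟩
  ∑[ d < K ] ∑[ u < n ] 𝟙 (h u ≟ d) * F d      ≡⟨ ∑-cong K (λ d → ∑-distribʳ-* n (F d) _) ⟩
  ∑[ d < K ] #fibre n h d * F d                ∎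

∑∑-fibres : ∀ n K (h : ℕ → ℕ) (X : ℕ → ℕ → ℕ) → (∀ u → u < n → h u < K) →
            ∑∑ n (λ u v → X (h u) (h v)) ≡ ∑∑ K (λ d e → #fibre n h d * #fibre n h e * X d e)
∑∑-fibres n K h X h<K = begin
  ∑[ u < n ] ∑[ v < n ] X (h u) (h v)          ≡⟨ ∑-cong n (λ u → ∑-fibres n K h (X (h u)) h<K) ⟩
  ∑[ u < n ] ∑[ e < K ] c e * X (h u) e        ≡⟨ ∑-comm n K _ ⟩
  ∑[ e < K ] ∑[ u < n ] c e * X (h u) e        ≡⟨ ∑-cong K (λ e → ∑-distribˡ-* n (c e) _) ⟩
  ∑[ e < K ] c e * (∑[ u < n ] X (h u) e)      ≡⟨ ∑-cong K (λ e → cong (c e *_) (∑-fibres n K h (flip X e) h<K)) ⟩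
  ∑[ e < K ] c e * (∑[ d < K ] c d * X d e)    ≡⟨ ∑-cong K (λ e → ∑-distribˡ-* K (c e) _) ⟨
  ∑[ e < K ] ∑[ d < K ] c e * (c d * X d e)    ≡⟨ ∑-comm K K _ ⟨
  ∑[ d < K ] ∑[ e < K ] c e * (c d * X d e)    ≡⟨ ∑-cong K (λ d → ∑-cong K (λ e → rearrange (c e) (c d) _)) ⟩
  ∑[ d < K ] ∑[ e < K ] c d * c e * X d e      ∎
  where
  c : ℕ → ℕ
  c = #fibre n h
  rearrange : ∀ x y z → x * (y * z) ≡ y * x * z
  rearrange = solve 3 (λ x y z → x :* (y :* z) := y :* x :* z) refl

sum-map-applyUpTo : ∀ (F g : ℕ → ℕ) n → sum (map F (applyUpTo g n)) ≡ ∑[ i < n ] F (g i)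
sum-map-applyUpTo F g zero    = refl
sum-map-applyUpTo F g (suc n) = cong (F (g 0) +_) (sum-map-applyUpTo F (g ∘ suc) n)

sum-map-filter : ∀ {P : ℕ → Set a} (P? : Decidable P) (F : ℕ → ℕ) xs →
                 sum (map F (filter P? xs)) ≡ sum (map (λ x → 𝟙 (P? x) * F x) xs)
sum-map-filter P? F []       = refl
sum-map-filter P? F (x ∷ xs) with does (P? x)
... | true  = cong₂ _+_ (sym (+-identityʳ (F x))) (sum-map-filter P? F xs)
... | false = sum-map-filter P? F xs

length-filter≡sum : ∀ {P : ℕ → Set a} (P? : Decidable P) xs →
                    length (filter P? xs) ≡ sum (map (𝟙 ∘ P?) xs)
length-filter≡sum P? []       = refl
length-filter≡sum P? (x ∷ xs) with does (P? x)
... | true  = cong suc (length-filter≡sum P? xs)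
... | false = length-filter≡sum P? xs

coprime-0⇔coprime-self : ∀ {d} → Coprime 0 d ⇔ Coprime d d
coprime-0⇔coprime-self = mk⇔ (λ coprime {i} (i∣d , _) → coprime (i ∣0 , i∣d))
                               (λ coprime {i} (_ , i∣d) → coprime (i∣d , i∣d))

-- φ counts over 1..d; since 0 and d are coprime to d simultaneously, 0..d-1 gives the same count.
φ≡∑ : ∀ d → φ d ≡ ∑[ k < d ] 𝟙 (coprime? k d)
φ≡∑ d = begin
  φ d                                ≡⟨ length-filter≡sum (λ k → coprime? k d) (map suc (upTo d)) ⟩
  sum (map f (map suc (upTo d)))     ≡⟨ cong sum (map-∘ (upTo d)) ⟨
  sum (map (f ∘ suc) (upTo d))       ≡⟨ sum-map-applyUpTo (f ∘ suc) id d ⟩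
  ∑[ k < d ] f (suc k)               ≡⟨ +-cancelˡ-≡ (f 0) _ _ shift ⟩
  ∑[ k < d ] f k                     ∎
  where
  f : ℕ → ℕ
  f k = 𝟙 (coprime? k d)
  shift : f 0 + (∑[ k < d ] f (suc k)) ≡ f 0 + ∑ d f
  shift = begin
    ∑ (suc d) f   ≡⟨ ∑-init-last d f ⟩
    ∑ d f + f d   ≡⟨ +-comm (∑ d f) (f d) ⟩
    f d + ∑ d f   ≡⟨ cong (_+ ∑ d f) (𝟙-cong coprime-0⇔coprime-self (coprime? 0 d) (coprime? d d)) ⟨
    f 0 + ∑ d f   ∎

ProperDivisor : ℕ → ℕ → Set
ProperDivisor n d = 1 < d × d < n × d ∣ n

properDivisor? : ∀ n d → Dec (ProperDivisor n d)
properDivisor? n d = (1 <? d) ×-dec (d <? n) ×-dec (d ∣? n)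

∑-properDivisor≡∑-from-2 : ∀ n (F : ℕ → ℕ) →
                  ∑[ d < suc n ] 𝟙 (properDivisor? n d) * F d ≡ ∑[ i < n ∸ 2 ] 𝟙 ((2 + i) ∣? n) * F (2 + i)
∑-properDivisor≡∑-from-2 0 F = refl
∑-properDivisor≡∑-from-2 1 F = refl
∑-properDivisor≡∑-from-2 n@(suc (suc k)) F = begin
  ∑[ i < suc k ] G (2 + i)            ≡⟨ ∑-init-last k (G ∘ (2 +_)) ⟩
  (∑[ i < k ] G (2 + i)) + G n        ≡⟨ cong (λ x → (∑[ i < k ] G (2 + i)) + x * F n)
                                           (𝟙-no n-improper (properDivisor? n n)) ⟩
  (∑[ i < k ] G (2 + i)) + 0          ≡⟨ +-identityʳ _ ⟩
  ∑[ i < k ] G (2 + i)                ≡⟨ ∑-cong< k (λ i i<k → cong (_* F (2 + i))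
                                           (𝟙-cong (proper⇔∣ i<k) (properDivisor? n (2 + i)) ((2 + i) ∣? n))) ⟩
  ∑[ i < k ] 𝟙 ((2 + i) ∣? n) * F (2 + i)  ∎
  where
  G : ℕ → ℕ
  G d = 𝟙 (properDivisor? n d) * F d
  n-improper : ¬ ProperDivisor n n
  n-improper (_ , n<n , _) = n≮n n n<n
  proper⇔∣ : ∀ {i} → i < k → ProperDivisor n (2 + i) ⇔ (2 + i) ∣ n
  proper⇔∣ i<k = mk⇔ (proj₂ ∘ proj₂) (λ 2+i∣n → s<s z<s , s<s (s<s i<k) , 2+i∣n)

sum-properDivisors : ∀ n (F : ℕ → ℕ) →
                     sum (map F (properDivisors n)) ≡ ∑[ d < suc n ] 𝟙 (properDivisor? n d) * F d
sum-properDivisors n F = begin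
  sum (map F (properDivisors n))            ≡⟨ sum-map-filter (_∣? n) F (map (2 +_) (upTo (n ∸ 2))) ⟩
  sum (map G (map (2 +_) (upTo (n ∸ 2))))   ≡⟨ cong sum (map-∘ (upTo (n ∸ 2))) ⟨
  sum (map (G ∘ (2 +_)) (upTo (n ∸ 2)))     ≡⟨ sum-map-applyUpTo (G ∘ (2 +_)) id (n ∸ 2) ⟩
  ∑[ i < n ∸ 2 ] G (2 + i)                  ≡⟨ ∑-properDivisor≡∑-from-2 n F ⟨
  ∑[ d < suc n ] 𝟙 (properDivisor? n d) * F d  ∎
  where
  G : ℕ → ℕ
  G d = 𝟙 (d ∣? n) * F d

Comparable : ℕ → ℕ → Set
Comparable d e = d ∣ e ⊎ e ∣ d

comparable? : ∀ d e → Dec (Comparable d e)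
comparable? d e = (d ∣? e) ⊎-dec (e ∣? d)

incomparable : ℕ → ℕ → ℕ
incomparable d e = 𝟙 (¬? (comparable? d e))

incomparable-sym : ∀ d e → incomparable d e ≡ incomparable e d
incomparable-sym d e = 𝟙-cong (mk⇔ (_∘ swap) (_∘ swap)) (¬? (comparable? d e)) (¬? (comparable? e d))

incomparable-refl : ∀ d → incomparable d d ≡ 0
incomparable-refl d = 𝟙-no (λ ¬c → ¬c (inj₁ ∣-refl)) (¬? (comparable? d d))

-- For d > 0, e ∣ d would force e ≤ d, so "d < e and d ∤ e" already makes d, e incomparable.
𝟙-<∤ : ∀ {d e} → 0 < d → 𝟙 ((d <? e) ×-dec ¬? (d ∣? e)) ≡ 𝟙 (d <? e) * incomparable d e
𝟙-<∤ {d} {e} 0<d = begin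
  𝟙 ((d <? e) ×-dec ¬? (d ∣? e))
    ≡⟨ 𝟙-cong (mk⇔ to from) ((d <? e) ×-dec ¬? (d ∣? e)) ((d <? e) ×-dec ¬? (comparable? d e)) ⟩
  𝟙 ((d <? e) ×-dec ¬? (comparable? d e))
    ≡⟨ 𝟙-× (d <? e) (¬? (comparable? d e)) ⟩
  𝟙 (d <? e) * incomparable d e ∎
  where
  to : d < e × ¬ d ∣ e → d < e × ¬ Comparable d e
  to (d<e , d∤e) = d<e , [ d∤e , (λ e∣d → <⇒≱ d<e (∣⇒≤ {{>-nonZero 0<d}} e∣d)) ]′
  from : d < e × ¬ Comparable d e → d < e × ¬ d ∣ e
  from (d<e , ¬c) = d<e , ¬c ∘ inj₁

∣-complement : ∀ {p x q y} .{{_ : NonZero x}} → p * x ≡ q * y → x ∣ y → q ∣ p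
∣-complement {p} {x} {q} px≡qy x∣y = *-cancelʳ-∣ x (subst (q * x ∣_) (sym px≡qy) (*-monoʳ-∣ q x∣y))

[m%n*k]%n≡[m*k]%n : ∀ m k n .{{_ : NonZero n}} → (m % n * k) % n ≡ (m * k) % n
[m%n*k]%n≡[m*k]%n m k n = begin
  (m % n * k) % n              ≡⟨ %-distribˡ-* (m % n) k n ⟩
  (m % n % n * (k % n)) % n    ≡⟨ cong (λ z → (z * (k % n)) % n) (m%n%n≡m%n m n) ⟩
  (m % n * (k % n)) % n        ≡⟨ %-distribˡ-* m k n ⟨
  (m * k) % n                  ∎

m≡[m+m]%n⇒m≡0 : ∀ {m n} .{{_ : NonZero n}} → m < n → m ≡ (m + m) % n → m ≡ 0
m≡[m+m]%n⇒m≡0 {zero}  _   _ = refl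
m≡[m+m]%n⇒m≡0 {suc m} {n} m<n m≡ = contradiction (divides ((suc m + suc m) / n) m≡qn) (>⇒∤ m<n)
  where
  m≡qn : suc m ≡ ((suc m + suc m) / n) * n
  m≡qn = +-cancelˡ-≡ (suc m) _ _
    (trans (m≡m%n+[m/n]*n (suc m + suc m) n) (cong (_+ ((suc m + suc m) / n) * n) (sym m≡)))

Irrelevant↔Fin𝟙 : (a? : Dec A) → Irrelevant A ↔ Fin (𝟙 a?)
Irrelevant↔Fin𝟙 (yes a) =
  mk↔ₛ′ (λ _ → Fin.zero) (λ _ → [ a ]) (λ { Fin.zero → refl ; (Fin.suc ()) }) (λ _ → refl)
Irrelevant↔Fin𝟙 (no ¬a) =
  mk↔ₛ′ (λ { [ a ] → ⊥-elim-irr (¬a a) }) (λ ()) (λ ()) (λ { [ a ] → ⊥-elim-irr (¬a a) })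

Irrelevant-cong : A ⇔ B → Irrelevant A ↔ Irrelevant B
Irrelevant-cong A⇔B =
  mk↔ₛ′ (λ { [ a ] → [ Equivalence.to A⇔B a ] }) (λ { [ b ] → [ Equivalence.from A⇔B b ] })
        (λ _ → refl) (λ _ → refl)

Σ-Fin↔Fin∑ : ∀ n (k : ℕ → ℕ) (A : Fin n → Set a) → (∀ i → A i ↔ Fin (k (toℕ i))) →
             Σ (Fin n) A ↔ Fin (∑ n k)
Σ-Fin↔Fin∑ zero    k A A↔ = mk↔ₛ′ (λ ()) (λ ()) (λ ()) (λ ())
Σ-Fin↔Fin∑ (suc n) k A A↔ = ↔-trans split
  (↔-trans (A↔ Fin.zero ⊎-↔ Σ-Fin↔Fin∑ n (k ∘ suc) (A ∘ Fin.suc) (A↔ ∘ Fin.suc)) (↔-sym +↔⊎))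
  where
  split : Σ (Fin (suc n)) A ↔ (A Fin.zero ⊎ Σ (Fin n) (A ∘ Fin.suc))
  split = mk↔ₛ′ (λ { (Fin.zero , x) → inj₁ x ; (Fin.suc i , x) → inj₂ (i , x) })
                (λ { (inj₁ x) → Fin.zero , x ; (inj₂ (i , x)) → Fin.suc i , x })
                (λ { (inj₁ _) → refl ; (inj₂ _) → refl })
                (λ { (Fin.zero , _) → refl ; (Fin.suc _ , _) → refl })

module Cyclic (N : ℕ) .{{N≢0 : NonZero N}} where

  order : ℕ → ℕ
  order u = quotient (gcd[m,n]∣n u N)

  N≡order*gcd : ∀ u → N ≡ order u * gcd u N
  N≡order*gcd u = _∣_.equality (gcd[m,n]∣n u N)

  order∣N : ∀ u → order u ∣ N
  order∣N u = quotient-∣ (gcd[m,n]∣n u N)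

  gcd[u,N]≢0 : ∀ u → NonZero (gcd u N)
  gcd[u,N]≢0 u = ≢-nonZero (gcd[m,n]≢0 u N (inj₂ (≢-nonZero⁻¹ N)))

  gcd∣⇔order∣ : ∀ a b → gcd a N ∣ b ⇔ order b ∣ order a
  gcd∣⇔order∣ a b = mk⇔ to from
    where
    to : gcd a N ∣ b → order b ∣ order a
    to g∣b = ∣-complement {{gcd[u,N]≢0 a}} (trans (sym (N≡order*gcd a)) (N≡order*gcd b))
                          (gcd-greatest g∣b (gcd[m,n]∣n a N))
    from : order b ∣ order a → gcd a N ∣ b
    from o∣o = ∣-trans (∣-complement {{quotient≢0 (gcd[m,n]∣n b N)}}
                         (trans (*-comm (gcd b N) (order b)) (trans (sym (N≡order*gcd b))
                           (trans (N≡order*gcd a) (*-comm (order a) (gcd a N)))))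
                         o∣o)
                       (gcd[m,n]∣m b N)

  toℕ-mod : ∀ k → toℕ (k mod N) ≡ k % N
  toℕ-mod k = toℕ-fromℕ< _

  toℕ-mod-N : ∀ x → toℕ x mod N ≡ x
  toℕ-mod-N x = toℕ-injective (trans (toℕ-mod (toℕ x)) (m<n⇒m%n≡m (toℕ<n x)))

  mod-⊕ : ∀ k l → (k + l) mod N ≡ (k mod N) ⊕ (l mod N)
  mod-⊕ k l = toℕ-injective (begin
    toℕ ((k + l) mod N)                   ≡⟨ toℕ-mod (k + l) ⟩
    (k + l) % N                           ≡⟨ %-distribˡ-+ k l N ⟩
    (k % N + l % N) % N                   ≡⟨ cong₂ (λ x y → (x + y) % N) (toℕ-mod k) (toℕ-mod l) ⟨
    (toℕ (k mod N) + toℕ (l mod N)) % N   ≡⟨ toℕ-mod _ ⟨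
    toℕ ((k mod N) ⊕ (l mod N))           ∎)

  scale : ℕ → Fin N → Fin N
  scale c x = (toℕ x * c) mod N

  scale-isEndo : ∀ c → IsEndo (scale c)
  scale-isEndo c x y = toℕ-injective (begin
    toℕ (scale c (x ⊕ y))                        ≡⟨ toℕ-mod _ ⟩
    (toℕ (x ⊕ y) * c) % N                        ≡⟨ cong (λ z → (z * c) % N) (toℕ-mod _) ⟩
    ((toℕ x + toℕ y) % N * c) % N                ≡⟨ [m%n*k]%n≡[m*k]%n (toℕ x + toℕ y) c N ⟩
    ((toℕ x + toℕ y) * c) % N                    ≡⟨ cong (_% N) (*-distribʳ-+ c (toℕ x) (toℕ y)) ⟩
    (toℕ x * c + toℕ y * c) % N                  ≡⟨ toℕ-mod _ ⟨
    toℕ ((toℕ x * c + toℕ y * c) mod N)          ≡⟨ cong toℕ (mod-⊕ (toℕ x * c) (toℕ y * c)) ⟩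
    toℕ (scale c x ⊕ scale c y)                  ∎)

  endo≗scale : ∀ {f} → IsEndo f → ∀ x → f x ≡ scale (toℕ (f (1 mod N))) x
  endo≗scale {f} endo x = toℕ-injective (begin
    toℕ (f x)                 ≡⟨ cong (toℕ ∘ f) (toℕ-mod-N x) ⟨
    toℕ (f (toℕ x mod N))     ≡⟨ linear (toℕ x) ⟩
    (toℕ x * c) % N           ≡⟨ toℕ-mod _ ⟨
    toℕ (scale c x)           ∎)
    where
    c : ℕ
    c = toℕ (f (1 mod N))
    f[0]≡0 : toℕ (f (0 mod N)) ≡ 0
    f[0]≡0 = m≡[m+m]%n⇒m≡0 (toℕ<n (f (0 mod N))) (begin
      toℕ (f (0 mod N))                            ≡⟨ cong (toℕ ∘ f) (mod-⊕ 0 0) ⟩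
      toℕ (f ((0 mod N) ⊕ (0 mod N)))              ≡⟨ cong toℕ (endo (0 mod N) (0 mod N)) ⟩
      toℕ (f (0 mod N) ⊕ f (0 mod N))              ≡⟨ toℕ-mod _ ⟩
      (toℕ (f (0 mod N)) + toℕ (f (0 mod N))) % N ∎)
    linear : ∀ k → toℕ (f (k mod N)) ≡ (k * c) % N
    linear zero    = trans f[0]≡0 (sym (m<n⇒m%n≡m (>-nonZero⁻¹ N)))
    linear (suc k) = begin
      toℕ (f (suc k mod N))               ≡⟨ cong (λ z → toℕ (f (z mod N))) (+-comm 1 k) ⟩
      toℕ (f ((k + 1) mod N))             ≡⟨ cong (toℕ ∘ f) (mod-⊕ k 1) ⟩
      toℕ (f ((k mod N) ⊕ (1 mod N)))     ≡⟨ cong toℕ (endo (k mod N) (1 mod N)) ⟩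
      toℕ (f (k mod N) ⊕ f (1 mod N))     ≡⟨ toℕ-mod _ ⟩
      (toℕ (f (k mod N)) + c) % N         ≡⟨ cong₂ (λ x y → (x + y) % N) (linear k)
                                                   (sym (m<n⇒m%n≡m (toℕ<n (f (1 mod N))))) ⟩
      ((k * c) % N + c % N) % N           ≡⟨ %-distribˡ-+ (k * c) c N ⟨
      (k * c + c) % N                     ≡⟨ cong (_% N) (+-comm (k * c) c) ⟩
      (suc k * c) % N                     ∎

  gcd-mod-multiple : ∀ a → ∃ λ c → (a * c) % N ≡ gcd a N % N
  gcd-mod-multiple a with Bézout.identity (gcd-GCD a N)
  ... | Bézout.+- x y g+yN≡xa = x , (begin
    (a * x) % N              ≡⟨ cong (_% N) (*-comm a x) ⟩
    (x * a) % N              ≡⟨ cong (_% N) g+yN≡xa ⟨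
    (gcd a N + y * N) % N    ≡⟨ [m+kn]%n≡m%n (gcd a N) y N ⟩
    gcd a N % N              ∎)
  -- Here gcd a N ≡ -x·a (mod N), and pred N ≡ -1 (mod N).
  ... | Bézout.-+ x y g+xa≡yN = x * pred N , (begin
    (a * (x * pred N)) % N                      ≡⟨ [m+kn]%n≡m%n _ y N ⟨
    (a * (x * pred N) + y * N) % N              ≡⟨ cong (λ z → (a * (x * pred N) + z) % N) g+xa≡yN ⟨
    (a * (x * pred N) + (gcd a N + x * a)) % N  ≡⟨ cong (_% N) (solve 4 (λ a x p g →
                                                     a :* (x :* p) :+ (g :+ x :* a) := g :+ x :* a :* (con 1 :+ p))
                                                     refl a x (pred N) (gcd a N)) ⟩
    (gcd a N + x * a * suc (pred N)) % N        ≡⟨ cong (λ z → (gcd a N + x * a * z) % N) (suc-pred N) ⟩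
    (gcd a N + x * a * N) % N                   ≡⟨ [m+kn]%n≡m%n (gcd a N) (x * a) N ⟩
    gcd a N % N                                 ∎)

  maps⇔gcd∣ : ∀ a b → Maps a b ⇔ gcd (toℕ a) N ∣ toℕ b
  maps⇔gcd∣ a b = mk⇔ to from
    where
    k : ℕ
    k = toℕ a
    to : Maps a b → gcd k N ∣ toℕ b
    to (f , endo , fa≡b) = subst (gcd k N ∣_) (begin
      (k * c) % N       ≡⟨ toℕ-mod _ ⟨
      toℕ (scale c a)   ≡⟨ cong toℕ (endo≗scale endo a) ⟨
      toℕ (f a)         ≡⟨ cong toℕ fa≡b ⟩
      toℕ b             ∎)
      (%-presˡ-∣ (∣m⇒∣m*n c (gcd[m,n]∣m k N)) (gcd[m,n]∣n k N))
      where
      c : ℕ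
      c = toℕ (f (1 mod N))
    from : gcd k N ∣ toℕ b → Maps a b
    from (divides t b≡t*g) = scale (c * t) , scale-isEndo (c * t) , toℕ-injective (begin
      toℕ (scale (c * t) a)    ≡⟨ toℕ-mod _ ⟩
      (k * (c * t)) % N        ≡⟨ cong (_% N) (*-assoc k c t) ⟨
      (k * c * t) % N          ≡⟨ [m%n*k]%n≡[m*k]%n (k * c) t N ⟨
      ((k * c) % N * t) % N    ≡⟨ cong (λ z → (z * t) % N) kc≡g ⟩
      (gcd k N % N * t) % N    ≡⟨ [m%n*k]%n≡[m*k]%n (gcd k N) t N ⟩
      (gcd k N * t) % N        ≡⟨ cong (_% N) (trans (*-comm (gcd k N) t) (sym b≡t*g)) ⟩
      toℕ b % N                ≡⟨ m<n⇒m%n≡m (toℕ<n b) ⟩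
      toℕ b                    ∎)
      where
      c : ℕ
      c = proj₁ (gcd-mod-multiple k)
      kc≡g : (k * c) % N ≡ gcd k N % N
      kc≡g = proj₂ (gcd-mod-multiple k)

  adjacent⇔comparable : ∀ a b → Adjacent a b ⇔ Comparable (order (toℕ a)) (order (toℕ b))
  adjacent⇔comparable a b = mk⇔ swap swap ⇔-∘ (maps⇔order∣ a b ⊎-⇔ maps⇔order∣ b a)
    where
    maps⇔order∣ : ∀ a b → Maps a b ⇔ order (toℕ b) ∣ order (toℕ a)
    maps⇔order∣ a b = gcd∣⇔order∣ (toℕ a) (toℕ b) ⇔-∘ maps⇔gcd∣ a b

  edge? : ∀ u v → Dec (u < v × Comparable (order u) (order v))
  edge? u v = (u <? v) ×-dec comparable? (order u) (order v)

  #edges : ℕ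
  #edges = ∑∑ N (λ u v → 𝟙 (edge? u v))

  Fin#edges↔Edge : Fin #edges ↔ Edge N
  Fin#edges↔Edge = ↔-sym (↔-trans Edge↔Σ
    (Σ-Fin↔Fin∑ N _ _ λ u → Σ-Fin↔Fin∑ N (λ v → 𝟙 (edge? (toℕ u) v)) _ λ v →
      ↔-trans (Irrelevant-cong (⇔-id _ ×-⇔ adjacent⇔comparable u v))
              (Irrelevant↔Fin𝟙 (edge? (toℕ u) (toℕ v)))))
    where
    Edge↔Σ : Edge N ↔ Σ (Fin N) λ u → Σ (Fin N) λ v → Irrelevant (u Fin.< v × Adjacent u v)
    Edge↔Σ = mk↔ₛ′ (λ { (edge u v u<v adj) → u , v , [ u<v , adj ] })
                   (λ { (u , v , [ p ]) → edge u v (proj₁ p) (proj₂ p) })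
                   (λ _ → refl) (λ _ → refl)

  #nonAdjacent : ℕ
  #nonAdjacent = ∑∑< N (λ u v → incomparable (order u) (order v))

  #edges+#nonAdjacent≡C2 : #edges + #nonAdjacent ≡ N C 2
  #edges+#nonAdjacent≡C2 = begin
    #edges + #nonAdjacent
      ≡⟨ cong (_+ #nonAdjacent)
              (∑-cong N (λ u → ∑-cong N (λ v → 𝟙-× (u <? v) (comparable? (order u) (order v))))) ⟩
    ∑∑< N (λ u v → 𝟙 (comparable? (order u) (order v))) + #nonAdjacent
      ≡⟨ ∑∑<-complement N (λ u v → comparable? (order u) (order v)) ⟩
    N C 2 ∎

  #order : ℕ → ℕ
  #order = #fibre N order

  #order-∤ : ∀ {d} → ¬ d ∣ N → #order d ≡ 0
  #order-∤ {d} d∤N = ∑-zero N (λ u _ → 𝟙-no (λ o≡d → d∤N (subst (_∣ N) o≡d (order∣N u))) (order u ≟ d))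

  #order-∣ : ∀ {d} → d ∣ N → #order d ≡ φ d
  #order-∣ {d} (divides k N≡kd) = begin
    ∑[ u < N ] 𝟙 (order u ≟ d)
      ≡⟨ ∑-cong N (λ u → 𝟙-cong (order≡⇔gcd≡ u) (order u ≟ d) (gcd u N ≟ k)) ⟩
    ∑[ u < N ] 𝟙 (gcd u N ≟ k)
      ≡⟨ cong (λ n → ∑[ u < n ] 𝟙 (gcd u N ≟ k)) (trans N≡kd (*-comm k d)) ⟩
    ∑[ u < d * k ] 𝟙 (gcd u N ≟ k)
      ≡⟨ ∑-multiples k d (λ u k∤u → 𝟙-no (k∤u ∘ gcd≡k⇒k∣ u) (gcd u N ≟ k)) ⟩
    ∑[ i < d ] 𝟙 (gcd (i * k) N ≟ k)
      ≡⟨ ∑-cong d (λ i → 𝟙-cong (gcd[ik,N]≡k⇔coprime i) (gcd (i * k) N ≟ k) (coprime? i d)) ⟩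
    ∑[ i < d ] 𝟙 (coprime? i d)
      ≡⟨ φ≡∑ d ⟨
    φ d ∎
    where
    instance
      k≢0 : NonZero k
      k≢0 = m*n≢0⇒m≢0 k {{subst NonZero N≡kd N≢0}}
      d≢0 : NonZero d
      d≢0 = m*n≢0⇒n≢0 k {{subst NonZero N≡kd N≢0}}
    order≡⇔gcd≡ : ∀ u → order u ≡ d ⇔ gcd u N ≡ k
    order≡⇔gcd≡ u = mk⇔
      (λ o≡d → *-cancelˡ-≡ (gcd u N) k d (trans (cong (_* gcd u N) (sym o≡d))
                 (trans (sym (N≡order*gcd u)) (trans N≡kd (*-comm k d)))))
      (λ g≡k → *-cancelʳ-≡ (order u) d k (trans (cong (order u *_) (sym g≡k))
                 (trans (sym (N≡order*gcd u)) (trans N≡kd (*-comm k d)))))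
    gcd≡k⇒k∣ : ∀ u → gcd u N ≡ k → k ∣ u
    gcd≡k⇒k∣ u g≡k = subst (_∣ u) g≡k (gcd[m,n]∣m u N)
    gcd[ik,N]≡k*gcd[i,d] : ∀ i → gcd (i * k) N ≡ k * gcd i d
    gcd[ik,N]≡k*gcd[i,d] i = trans (cong₂ gcd (*-comm i k) N≡kd) (sym (c*gcd[m,n]≡gcd[cm,cn] k i d))
    gcd[ik,N]≡k⇔coprime : ∀ i → gcd (i * k) N ≡ k ⇔ Coprime i d
    gcd[ik,N]≡k⇔coprime i = mk⇔ {B = Coprime i d}
      (λ g≡k → gcd≡1⇒coprime (*-cancelˡ-≡ (gcd i d) 1 k
                 (trans (sym (gcd[ik,N]≡k*gcd[i,d] i)) (trans g≡k (sym (*-identityʳ k))))))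
      (λ (coprime : Coprime i d) → trans (gcd[ik,N]≡k*gcd[i,d] i)
                                      (trans (cong (k *_) (coprime⇒gcd≡1 coprime)) (*-identityʳ k)))

  ψ : ℕ → ℕ
  ψ d = 𝟙 (properDivisor? N d) * φ d

  ψ-∤ : ∀ {d} → ¬ d ∣ N → ψ d ≡ 0
  ψ-∤ {d} d∤N = cong (_* φ d) (𝟙-no (λ (_ , _ , d∣N) → d∤N d∣N) (properDivisor? N d))

  incomparable⇒proper : ∀ {d e} → d ∣ N → e ∣ N → ¬ Comparable d e → ProperDivisor N d
  incomparable⇒proper {d} {e} d∣N e∣N ¬c = 1<d d∣N (¬c ∘ inj₁) , d<N , d∣N
    where
    1<d : ∀ {d} → d ∣ N → ¬ d ∣ e → 1 < d
    1<d {zero}        0∣N _   = contradiction (0∣⇒≡0 0∣N) (≢-nonZero⁻¹ N)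
    1<d {suc zero}    _   1∤e = contradiction (1∣ e) 1∤e
    1<d {suc (suc _)} _   _   = s<s z<s
    d<N : d < N
    d<N = ≤∧≢⇒< (∣⇒≤ d∣N) (λ d≡N → ¬c (inj₂ (subst (e ∣_) (sym d≡N) e∣N)))

  #order≡ψ : ∀ {d e} → d ∣ N → e ∣ N → ¬ Comparable d e → #order d ≡ ψ d
  #order≡ψ {d} d∣N e∣N ¬c = begin
    #order d   ≡⟨ #order-∣ d∣N ⟩
    φ d        ≡⟨ *-identityˡ (φ d) ⟨
    1 * φ d    ≡⟨ cong (_* φ d) (𝟙-yes (incomparable⇒proper d∣N e∣N ¬c) (properDivisor? N d)) ⟨
    ψ d        ∎

  #order*#order≡ψ*ψ : ∀ {d e} → ¬ Comparable d e → #order d * #order e ≡ ψ d * ψ e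
  #order*#order≡ψ*ψ {d} {e} ¬c = by-cases (d ∣? N) (e ∣? N)
    where
    by-cases : Dec (d ∣ N) → Dec (e ∣ N) → #order d * #order e ≡ ψ d * ψ e
    by-cases (yes d∣N) (yes e∣N) = cong₂ _*_ (#order≡ψ d∣N e∣N ¬c) (#order≡ψ e∣N d∣N (¬c ∘ swap))
    by-cases (no d∤N)  _         =
      trans (cong (_* #order e) (#order-∤ d∤N)) (sym (cong (_* ψ e) (ψ-∤ d∤N)))
    by-cases (yes _)   (no e∤N)  = begin
      #order d * #order e   ≡⟨ cong (#order d *_) (#order-∤ e∤N) ⟩
      #order d * 0          ≡⟨ *-zeroʳ (#order d) ⟩
      0                     ≡⟨ *-zeroʳ (ψ d) ⟨
      ψ d * 0               ≡⟨ cong (ψ d *_) (ψ-∤ e∤N) ⟨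
      ψ d * ψ e             ∎

  weight : ℕ → ℕ → ℕ
  weight d e = ψ d * ψ e * incomparable d e

  weight-sym : ∀ d e → weight d e ≡ weight e d
  weight-sym d e = cong₂ _*_ (*-comm (ψ d) (ψ e)) (incomparable-sym d e)

  weight-refl : ∀ d → weight d d ≡ 0
  weight-refl d = trans (cong (ψ d * ψ d *_) (incomparable-refl d)) (*-zeroʳ (ψ d * ψ d))

  nonDivSum≡∑∑<weight : nonDivSum N ≡ ∑∑< (suc N) weight
  nonDivSum≡∑∑<weight = begin
    nonDivSum N
      ≡⟨ sum-properDivisors N (λ d → sum (map (λ e → φ d * φ e) (filter (Q d) (properDivisors N)))) ⟩
    ∑[ d < suc N ] 𝟙 (properDivisor? N d) * sum (map (λ e → φ d * φ e) (filter (Q d) (properDivisors N)))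
      ≡⟨ ∑-cong (suc N) (λ d → cong (𝟙 (properDivisor? N d) *_)
           (trans (sum-map-filter (Q d) (λ e → φ d * φ e) (properDivisors N))
                  (sum-properDivisors N (λ e → 𝟙 (Q d e) * (φ d * φ e))))) ⟩
    ∑[ d < suc N ] 𝟙 (properDivisor? N d) * (∑[ e < suc N ] summand d e)
      ≡⟨ ∑-cong (suc N) (λ d → trans (sym (∑-distribˡ-* (suc N) (𝟙 (properDivisor? N d)) (summand d)))
                                     (∑-cong (suc N) (termwise d))) ⟩
    ∑∑< (suc N) weight ∎
    where
    Q : ∀ d e → Dec (d < e × ¬ d ∣ e)
    Q d e = (d <? e) ×-dec ¬? (d ∣? e)
    summand : ℕ → ℕ → ℕ
    summand d e = 𝟙 (properDivisor? N e) * (𝟙 (Q d e) * (φ d * φ e))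
    termwise : ∀ d e → 𝟙 (properDivisor? N d) * (𝟙 (properDivisor? N e) * (𝟙 (Q d e) * (φ d * φ e)))
                     ≡ 𝟙 (d <? e) * weight d e
    termwise d e = begin
      p * (q * (𝟙 (Q d e) * (φ d * φ e)))
        ≡⟨ solve 4 (λ p q r f → p :* (q :* (r :* f)) := r :* p :* (q :* f)) refl p q (𝟙 (Q d e)) (φ d * φ e) ⟩
      𝟙 (Q d e) * p * (q * (φ d * φ e))
        ≡⟨ cong (_* (q * (φ d * φ e)))
             (*𝟙-cong (properDivisor? N d) (λ (1<d , _) → 𝟙-<∤ {d} {e} (<-trans z<s 1<d))) ⟩
      𝟙 (d <? e) * incomparable d e * p * (q * (φ d * φ e))
        ≡⟨ solve 6 (λ l i p q x y → l :* i :* p :* (q :* (x :* y)) := l :* (p :* x :* (q :* y) :* i))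
             refl (𝟙 (d <? e)) (incomparable d e) p q (φ d) (φ e) ⟩
      𝟙 (d <? e) * weight d e ∎
      where
      p q : ℕ
      p = 𝟙 (properDivisor? N d)
      q = 𝟙 (properDivisor? N e)

  #nonAdjacent≡nonDivSum : #nonAdjacent ≡ nonDivSum N
  #nonAdjacent≡nonDivSum = *-cancelˡ-≡ #nonAdjacent (nonDivSum N) 2 (begin
    2 * #nonAdjacent
      ≡⟨ ∑∑-symmetric N _ (λ u v → incomparable-sym (order u) (order v)) (incomparable-refl ∘ order) ⟨
    ∑∑ N (λ u v → incomparable (order u) (order v))
      ≡⟨ ∑∑-fibres N (suc N) order incomparable (λ u _ → s<s (∣⇒≤ (order∣N u))) ⟩
    ∑∑ (suc N) (λ d e → #order d * #order e * incomparable d e)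
      ≡⟨ ∑-cong (suc N) (λ d → ∑-cong (suc N) (λ e → *𝟙-cong (¬? (comparable? d e)) #order*#order≡ψ*ψ)) ⟩
    ∑∑ (suc N) weight
      ≡⟨ ∑∑-symmetric (suc N) weight weight-sym weight-refl ⟩
    2 * ∑∑< (suc N) weight
      ≡⟨ cong (2 *_) nonDivSum≡∑∑<weight ⟨
    2 * nonDivSum N ∎)

theorem2p6 : (n : ℕ) .{{_ : NonZero n}} →
    Σ ℕ λ e → (Fin e ↔ Edge n) × (e + nonDivSum n ≡ n C 2)
theorem2p6 n = #edges , Fin#edges↔Edge , (begin
  #edges + nonDivSum n     ≡⟨ cong (#edges +_) #nonAdjacent≡nonDivSum ⟨
  #edges + #nonAdjacent    ≡⟨ #edges+#nonAdjacent≡C2 ⟩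
  n C 2                    ∎)
  where open Cyclic n
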